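{- Let $(Q,\lhd)$ be a finite quandle and let $Q=Q_1\amalg Q_2\amalg\cdots\amalg Q_n$ be its decomposition into orbits. Let $\mathcal{T}$ be a topology on $Q$ such that for every $i\in\{1,\dots,n\}$ the subspace topology $\mathcal{T}_{|Q_i}$ is the coarse (indiscrete) topology on $Q_i$. Then $\mathcal{T}$ is $Q$-compatible.
   Context: A quandle is a set $Q$ with a binary operation $\lhd$ such that (i) $a\lhd a=a$ for all $a$; (ii) for all $a,b$ there is a unique $c$ with $a=c\lhd b$; (iii) $(a\lhd b)\lhd c=(a\lhd c)\lhd(b\lhd c)$ for all $a,b,c$. The orbits of $Q$ are the equivalence classes of the equivalence relation on $Q$ generated (as reflexive–symmetric–transitive closure) by the relation $x\,\tilde{\mathcal R}\,y$ iff there exists $z\in Q$ with $x=y\lhd z$ or $y=x\lhd z$. A topology $\mathcal{T}$ on $Q$ is called $Q$-compatible if the map $Q\times Q\to Q$, $(a,b)\mapsto a\lhd b$, is continuous (product topology on $Q\times Q$) and for every $b\in Q$ the map $a\mapsto a\lhd b$ is a homeomorphism of $(Q,\mathcal{T})$. -}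

module Defs where

open import Data.Nat using (ℕ)
open import Data.Fin using (Fin)
open import Data.Fin.Subset using (Subset; _∈_; _∉_; _∪_; _∩_; ⊥; ⊤)
open import Data.Vec using (tabulate; lookup)
open import Data.List using (List; foldr)
open import Data.List.Relation.Unary.All using (All)
open import Data.Product using (Σ; _×_; _,_; ∃)
open import Data.Sum using (_⊎_)
open import Relation.Binary.PropositionalEquality using (_≡_)
open import Relation.Binary.Construct.Closure.Equivalence using (EqClosure)
open import Level using (0ℓ) renaming (suc to lsuc)

-- A finite quandle on the carrier Fin m (every finite set is in bijection with some Fin m).
record IsQuandle (m : ℕ) (_◁_ : Fin m → Fin m → Fin m) : Set where
  field
    idem      : ∀ a → a ◁ a ≡ a
    rdiv      : ∀ a b → Σ (Fin m) λ c → a ≡ c ◁ b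
    rdiv-uniq : ∀ a b c c′ → a ≡ c ◁ b → a ≡ c′ ◁ b → c ≡ c′
    rdist     : ∀ a b c → (a ◁ b) ◁ c ≡ (a ◁ c) ◁ (b ◁ c)

R̃ : {m : ℕ} → (Fin m → Fin m → Fin m) → Fin m → Fin m → Set
R̃ {m} _◁_ x y = Σ (Fin m) λ z → (x ≡ y ◁ z) ⊎ (y ≡ x ◁ z)

SameOrbit : {m : ℕ} → (Fin m → Fin m → Fin m) → Fin m → Fin m → Set
SameOrbit _◁_ = EqClosure (R̃ _◁_)

⋃ : {m : ℕ} → List (Subset m) → Subset m
⋃ = foldr _∪_ ⊥

-- Since Fin m has finitely many subsets, closure under arbitrary unions is
-- equivalent to closure under unions of finite lists of open sets.
record IsTopology (m : ℕ) (IsOpen : Subset m → Set) : Set where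
  field
    open-⊤ : IsOpen ⊤
    open-⋃ : ∀ (Us : List (Subset m)) → All IsOpen Us → IsOpen (⋃ Us)
    open-∩ : ∀ U V → IsOpen U → IsOpen V → IsOpen (U ∩ V)

preimage : {m k : ℕ} → (Fin k → Fin m) → Subset m → Subset k
preimage f V = tabulate (λ x → lookup V (f x))

Continuous : {m : ℕ} → (Subset m → Set) → (Fin m → Fin m) → Set
Continuous {m} IsOpen f = ∀ (V : Subset m) → IsOpen V → IsOpen (preimage f V)

-- Continuity of a binary map Q × Q → Q for the product topology:
-- the preimage of every open V is open in Q × Q, i.e. every point of it
-- has an open box neighbourhood U × W contained in it.
Continuous₂ : {m : ℕ} → (Subset m → Set) → (Fin m → Fin m → Fin m) → Set
Continuous₂ {m} IsOpen _◁_ =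
  ∀ (V : Subset m) → IsOpen V → ∀ (a b : Fin m) → (a ◁ b) ∈ V →
    Σ (Subset m) λ U → Σ (Subset m) λ W →
      IsOpen U × IsOpen W × a ∈ U × b ∈ W ×
      (∀ x y → x ∈ U → y ∈ W → (x ◁ y) ∈ V)

IsHomeomorphism : {m : ℕ} → (Subset m → Set) → (Fin m → Fin m) → Set
IsHomeomorphism {m} IsOpen f =
  Σ (Fin m → Fin m) λ g →
    (∀ x → g (f x) ≡ x) × (∀ y → f (g y) ≡ y) ×
    Continuous IsOpen f × Continuous IsOpen g

QCompatible : {m : ℕ} → (Fin m → Fin m → Fin m) → (Subset m → Set) → Set
QCompatible {m} _◁_ IsOpen =
  Continuous₂ IsOpen _◁_ × (∀ (b : Fin m) → IsHomeomorphism IsOpen (λ a → a ◁ b))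

-- The subspace topology on the orbit of x is indiscrete: the open sets of the
-- subspace are the traces U ∩ Orbit(x), U open, and each must be ∅ or Orbit(x).
OrbitIndiscrete : {m : ℕ} → (Fin m → Fin m → Fin m) → (Subset m → Set) → Fin m → Set
OrbitIndiscrete {m} _◁_ IsOpen x =
  ∀ (U : Subset m) → IsOpen U →
    (∀ y → SameOrbit _◁_ x y → y ∉ U) ⊎ (∀ y → SameOrbit _◁_ x y → y ∈ U)

{-# OPTIONS --safe #-}

-- An open set meets every orbit in ∅ or in the whole orbit, so it is a union
-- of orbits. Right translation by b and its inverse (right division by b) move
-- each point only within its orbit, hence take every open set to itself under
-- preimage; and for the operation itself, V × Q is an open box around any
-- (a , b) with a ◁ b ∈ V, because a lies in the orbit of a ◁ b.
module Submission where

open import Defs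
open import Data.Nat using (ℕ)
open import Data.Fin using (Fin)
open import Data.Fin.Subset using (Subset; _∈_; ⊤)
open import Data.Fin.Subset.Properties using (∈⊤; ⊆-antisym)
open import Data.Vec.Properties using ([]=⇒lookup; lookup⇒[]=; lookup∘tabulate)
open import Data.Product using (_,_; proj₁; proj₂)
open import Data.Sum using (inj₁; inj₂)
open import Data.Empty using (⊥-elim)
open import Relation.Binary.PropositionalEquality using (_≡_; refl; sym; trans; subst)
open import Relation.Binary.Construct.Closure.Equivalence using (return; symmetric)
open import Relation.Binary.Construct.Closure.ReflexiveTransitive using (ε)

∈-preimage⁺ : ∀ {m k} (f : Fin k → Fin m) (V : Subset m) {x} →
              f x ∈ V → x ∈ preimage f V
∈-preimage⁺ f V {x} fx∈V =
  lookup⇒[]= x _ (trans (lookup∘tabulate _ x) ([]=⇒lookup fx∈V))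

∈-preimage⁻ : ∀ {m k} (f : Fin k → Fin m) (V : Subset m) {x} →
              x ∈ preimage f V → f x ∈ V
∈-preimage⁻ f V {x} x∈f⁻¹V =
  lookup⇒[]= (f x) V (trans (sym (lookup∘tabulate _ x)) ([]=⇒lookup x∈f⁻¹V))

module _ {m : ℕ} (_◁_ : Fin m → Fin m → Fin m) where

  sameOrbit-◁ : ∀ x y → SameOrbit _◁_ x (x ◁ y)
  sameOrbit-◁ x y = return (y , inj₂ refl)

  OrbitPreserving : (Fin m → Fin m) → Set
  OrbitPreserving f = ∀ x → SameOrbit _◁_ x (f x)

  module _ {IsOpen : Subset m → Set}
           (indiscrete : ∀ x → OrbitIndiscrete _◁_ IsOpen x) where

    open-saturated : ∀ {V} → IsOpen V → ∀ {x y} →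
                     SameOrbit _◁_ x y → x ∈ V → y ∈ V
    open-saturated {V} V-open {x} x∼y x∈V with indiscrete x V V-open
    ... | inj₁ orbit∩V≡∅ = ⊥-elim (orbit∩V≡∅ x ε x∈V)
    ... | inj₂ orbit⊆V   = orbit⊆V _ x∼y

    preimage-orbitPreserving : ∀ {f} → OrbitPreserving f →
                               ∀ {V} → IsOpen V → preimage f V ≡ V
    preimage-orbitPreserving {f} f-pres {V} V-open = ⊆-antisym
      (λ {x} x∈f⁻¹V → open-saturated V-open (symmetric _ (f-pres x)) (∈-preimage⁻ f V x∈f⁻¹V))
      (λ {x} x∈V → ∈-preimage⁺ f V (open-saturated V-open (f-pres x) x∈V))

    continuous-orbitPreserving : ∀ {f} → OrbitPreserving f → Continuous IsOpen f
    continuous-orbitPreserving f-pres V V-open =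
      subst IsOpen (sym (preimage-orbitPreserving f-pres V-open)) V-open

    continuous₂-◁ : IsOpen ⊤ → Continuous₂ IsOpen _◁_
    continuous₂-◁ ⊤-open V V-open a b ab∈V =
      V , ⊤ , V-open , ⊤-open ,
      open-saturated V-open (symmetric _ (sameOrbit-◁ a b)) ab∈V , ∈⊤ ,
      λ x y x∈V _ → open-saturated V-open (sameOrbit-◁ x y) x∈V

    module _ (quandle : IsQuandle m _◁_) (b : Fin m) where
      open IsQuandle quandle using (rdiv; rdiv-uniq)

      _◁⁻¹b : Fin m → Fin m
      y ◁⁻¹b = proj₁ (rdiv y b)

      ◁⁻¹b-orbitPreserving : OrbitPreserving _◁⁻¹b
      ◁⁻¹b-orbitPreserving y = return (b , inj₁ (proj₂ (rdiv y b)))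

      ◁b-◁⁻¹b : ∀ x → (x ◁ b) ◁⁻¹b ≡ x
      ◁b-◁⁻¹b x = rdiv-uniq (x ◁ b) b _ x (proj₂ (rdiv (x ◁ b) b)) refl

      ◁⁻¹b-◁b : ∀ y → (y ◁⁻¹b) ◁ b ≡ y
      ◁⁻¹b-◁b y = sym (proj₂ (rdiv y b))

      isHomeomorphism-◁ : IsHomeomorphism IsOpen (_◁ b)
      isHomeomorphism-◁ =
        _◁⁻¹b , ◁b-◁⁻¹b , ◁⁻¹b-◁b ,
        continuous-orbitPreserving (λ x → sameOrbit-◁ x b) ,
        continuous-orbitPreserving ◁⁻¹b-orbitPreserving

mainTheorem3 : (m : ℕ) (_◁_ : Fin m → Fin m → Fin m) → IsQuandle m _◁_ →
               (IsOpen : Subset m → Set) → IsTopology m IsOpen →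
               (∀ (x : Fin m) → OrbitIndiscrete _◁_ IsOpen x) →
               QCompatible _◁_ IsOpen
mainTheorem3 m _◁_ quandle IsOpen topology indiscrete =
  continuous₂-◁ _◁_ indiscrete (IsTopology.open-⊤ topology) ,
  isHomeomorphism-◁ _◁_ indiscrete quandle
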